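{- Let $G$ be an almost well-covered graph. Then $G_2$ is a complete graph, i.e., any two vertices of type $2$ are adjacent.
   Context: All graphs are finite and simple. For a graph $G$, $\alpha(G)$ is the maximum size of an independent set and $i(G)$ is the minimum size of an inclusion-maximal independent set; $G$ is almost well-covered if $\alpha(G)-i(G)=1$. Types: let $U$ be the set of vertices whose connected component in $G$ is a complete graph. In $G-U$, a leaf is a vertex of degree $1$ and an internal vertex is a vertex that is not a leaf. An internal vertex of $G-U$ adjacent to exactly $k$ leaves is of type $k$; every vertex of $U$ is of type $0$. $G_2$ denotes the subgraph of $G$ induced by all vertices of type $2$. -}

module Defs where

open import Data.Nat using (ℕ; _≤_; _+_)
open import Data.Fin using (Fin)
open import Data.Fin.Subset using (Subset; _∈_; _∉_; ∣_∣)
open import Data.Bool using (Bool; true; false)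
open import Data.Product using (Σ; ∃; ∃-syntax; _×_; _,_)
open import Relation.Binary.PropositionalEquality using (_≡_; _≢_)
open import Relation.Nullary using (¬_)
open import Data.Sum using (_⊎_)

record Graph (n : ℕ) : Set where
  field
    adj   : Fin n → Fin n → Bool
    sym   : ∀ u v → adj u v ≡ adj v u
    irrefl : ∀ v → adj v v ≡ false

module _ {n : ℕ} (G : Graph n) where
  open Graph G

  Adj : Fin n → Fin n → Set
  Adj u v = adj u v ≡ true

  Independent : Subset n → Set
  Independent S = ∀ u v → u ∈ S → v ∈ S → ¬ Adj u v

  MaximalIndependent : Subset n → Set
  MaximalIndependent S =
    Independent S × (∀ v → v ∉ S → ∃[ u ] (u ∈ S × Adj u v))

  IsAlpha : ℕ → Set
  IsAlpha k = (∃[ S ] (Independent S × ∣ S ∣ ≡ k))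
            × (∀ S → Independent S → ∣ S ∣ ≤ k)

  IsIndepDom : ℕ → Set
  IsIndepDom k = (∃[ S ] (MaximalIndependent S × ∣ S ∣ ≡ k))
               × (∀ S → MaximalIndependent S → k ≤ ∣ S ∣)

  AlmostWellCovered : Set
  AlmostWellCovered = ∃[ a ] ∃[ b ] (IsAlpha a × IsIndepDom b × a ≡ b + 1)

  data Reach (u : Fin n) : Fin n → Set where
    here : Reach u u
    step : ∀ {v w} → Reach u v → Adj v w → Reach u w

  InU : Fin n → Set
  InU v = ∀ x y → Reach v x → Reach v y → x ≢ y → Adj x y

  Leaf : Fin n → Set
  Leaf v = ¬ InU v ×
    (∃[ w ] (¬ InU w × Adj v w × (∀ w′ → ¬ InU w′ → Adj v w′ → w′ ≡ w)))

  Internal : Fin n → Set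
  Internal v = ¬ InU v × ¬ Leaf v

  Type2 : Fin n → Set
  Type2 v = Internal v ×
    (∃[ l₁ ] ∃[ l₂ ] (l₁ ≢ l₂ × Leaf l₁ × Leaf l₂ × Adj v l₁ × Adj v l₂
       × (∀ l → Leaf l → Adj v l → (l ≡ l₁ ⊎ l ≡ l₂))))

-- Suppose two type-2 vertices u ≠ v were non-adjacent, and extend {u, v} to an
-- inclusion-maximal independent set M, so i(G) ≤ |M|. The two leaves at u have u
-- as their only neighbour, so replacing u by them keeps M independent and grows
-- it by one; doing the same at v gives an independent set of size |M| + 2 ≥ i(G) + 2,
-- which exceeds α(G) = i(G) + 1.
module Submission where

open import Defs
open import Data.Bool using (true)
import Data.Bool as Bool
open import Data.Empty using (⊥-elim)
open import Data.Fin using (Fin)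
open import Data.Fin.Properties using (any?)
open import Data.Fin.Subset using (Subset; _∈_; _∉_; _⊆_; ∣_∣; ⁅_⁆; _∪_; _─_; _-_; inside; outside)
open import Data.Fin.Subset.Properties
  using (_∈?_; drop-∷-⊆; p⊆p∪q; q⊆p∪q; x∈p∪q⁻; x∈⁅x⁆; x∈⁅y⁆⇒x≡y; ∣⁅x⁆∣≡1; p─q⊆p; x∈p∧x≢y⇒x∈p-y)
open import Data.List.Base using (List; []; _∷_; allFin)
open import Data.List.Membership.Propositional.Properties using (∈-allFin)
import Data.List.Membership.Propositional as List
import Data.List.Relation.Unary.Any as Any
open import Data.Nat using (ℕ; suc; _+_; s≤s)
open import Data.Nat.Properties using (+-suc; +-comm; +-assoc; suc-injective; 1+n≰n; module ≤-Reasoning)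
open import Data.Product using (∃-syntax; _×_; _,_; proj₁; proj₂)
open import Data.Sum using (_⊎_; inj₁; inj₂)
open import Data.Vec.Base using ([]; _∷_; here; there)
open import Function using (_∘_)
open import Relation.Nullary using (¬_; Dec; yes; no)
open import Relation.Nullary.Decidable using (_×-dec_; decidable-stable)
open import Relation.Binary.PropositionalEquality
  using (_≡_; _≢_; refl; sym; trans; cong; cong₂; subst; module ≡-Reasoning)

∣p∪q∣≡∣p∣+∣q∣ : ∀ {n} {p q : Subset n} → (∀ {x} → x ∈ p → x ∉ q) → ∣ p ∪ q ∣ ≡ ∣ p ∣ + ∣ q ∣
∣p∪q∣≡∣p∣+∣q∣ {p = []} {[]} _ = refl
∣p∪q∣≡∣p∣+∣q∣ {p = outside ∷ p} {outside ∷ q} disj = ∣p∪q∣≡∣p∣+∣q∣ (λ x∈p → disj (there x∈p) ∘ there)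
∣p∪q∣≡∣p∣+∣q∣ {p = outside ∷ p} {inside ∷ q} disj =
  trans (cong suc (∣p∪q∣≡∣p∣+∣q∣ (λ x∈p → disj (there x∈p) ∘ there))) (sym (+-suc ∣ p ∣ ∣ q ∣))
∣p∪q∣≡∣p∣+∣q∣ {p = inside ∷ p} {outside ∷ q} disj = cong suc (∣p∪q∣≡∣p∣+∣q∣ (λ x∈p → disj (there x∈p) ∘ there))
∣p∪q∣≡∣p∣+∣q∣ {p = inside ∷ p} {inside ∷ q} disj = ⊥-elim (disj here here)

∣p─q∣+∣q∣≡∣p∣ : ∀ {n} {p q : Subset n} → q ⊆ p → ∣ p ─ q ∣ + ∣ q ∣ ≡ ∣ p ∣
∣p─q∣+∣q∣≡∣p∣ {p = []} {[]} _ = refl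
∣p─q∣+∣q∣≡∣p∣ {p = outside ∷ p} {outside ∷ q} q⊆p = ∣p─q∣+∣q∣≡∣p∣ (drop-∷-⊆ q⊆p)
∣p─q∣+∣q∣≡∣p∣ {p = inside ∷ p} {outside ∷ q} q⊆p = cong suc (∣p─q∣+∣q∣≡∣p∣ (drop-∷-⊆ q⊆p))
∣p─q∣+∣q∣≡∣p∣ {p = inside ∷ p} {inside ∷ q} q⊆p =
  trans (+-suc ∣ p ─ q ∣ ∣ q ∣) (cong suc (∣p─q∣+∣q∣≡∣p∣ (drop-∷-⊆ q⊆p)))
∣p─q∣+∣q∣≡∣p∣ {p = outside ∷ p} {inside ∷ q} q⊆p with () ← q⊆p here

x∈p⇒∣p-x∣+1≡∣p∣ : ∀ {n} {p : Subset n} {x} → x ∈ p → ∣ p - x ∣ + 1 ≡ ∣ p ∣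
x∈p⇒∣p-x∣+1≡∣p∣ {p = p} {x} x∈p =
  trans (cong (∣ p - x ∣ +_) (sym (∣⁅x⁆∣≡1 x)))
        (∣p─q∣+∣q∣≡∣p∣ (λ y∈⁅x⁆ → subst (_∈ p) (sym (x∈⁅y⁆⇒x≡y x y∈⁅x⁆)) x∈p))

x∈p─q⇒x∉q : ∀ {n} {p q : Subset n} {x} → x ∈ p ─ q → x ∉ q
x∈p─q⇒x∉q {p = inside ∷ p} {outside ∷ q} here ()
x∈p─q⇒x∉q {p = _ ∷ p} {_ ∷ q} (there x∈p─q) (there x∈q) = x∈p─q⇒x∉q x∈p─q x∈q

x∈p-y⇒x≢y : ∀ {n} {p : Subset n} {x y} → x ∈ p - y → x ≢ y
x∈p-y⇒x≢y {y = y} x∈p-y refl = x∈p─q⇒x∉q x∈p-y (x∈⁅x⁆ y)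

x∈⁅y⁆∪⁅z⁆⁻ : ∀ {n} {x y z : Fin n} → x ∈ ⁅ y ⁆ ∪ ⁅ z ⁆ → x ≡ y ⊎ x ≡ z
x∈⁅y⁆∪⁅z⁆⁻ {y = y} {z} x∈ with x∈p∪q⁻ ⁅ y ⁆ ⁅ z ⁆ x∈
... | inj₁ x∈⁅y⁆ = inj₁ (x∈⁅y⁆⇒x≡y y x∈⁅y⁆)
... | inj₂ x∈⁅z⁆ = inj₂ (x∈⁅y⁆⇒x≡y z x∈⁅z⁆)

∣⁅x⁆∪⁅y⁆∣≡2 : ∀ {n} {x y : Fin n} → x ≢ y → ∣ ⁅ x ⁆ ∪ ⁅ y ⁆ ∣ ≡ 2
∣⁅x⁆∪⁅y⁆∣≡2 {x = x} {y} x≢y = begin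
  ∣ ⁅ x ⁆ ∪ ⁅ y ⁆ ∣     ≡⟨ ∣p∪q∣≡∣p∣+∣q∣ disjoint ⟩
  ∣ ⁅ x ⁆ ∣ + ∣ ⁅ y ⁆ ∣ ≡⟨ cong₂ _+_ (∣⁅x⁆∣≡1 x) (∣⁅x⁆∣≡1 y) ⟩
  2                     ∎
  where
  open ≡-Reasoning
  disjoint : ∀ {z} → z ∈ ⁅ x ⁆ → z ∉ ⁅ y ⁆
  disjoint z∈⁅x⁆ z∈⁅y⁆ = x≢y (trans (sym (x∈⁅y⁆⇒x≡y x z∈⁅x⁆)) (x∈⁅y⁆⇒x≡y y z∈⁅y⁆))

module _ {n : ℕ} (G : Graph n) where
  open Graph G using (adj; irrefl) renaming (sym to adj-comm)

  Adj-sym : ∀ {x y} → Adj G x y → Adj G y x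
  Adj-sym {x} {y} = trans (adj-comm y x)

  Adj-irrefl : ∀ {x} → ¬ Adj G x x
  Adj-irrefl {x} x~x with () ← trans (sym x~x) (irrefl x)

  Reach-trans : ∀ {x y z} → Reach G x y → Reach G y z → Reach G x z
  Reach-trans r here = r
  Reach-trans r (step r′ a) = step (Reach-trans r r′) a

  InU-adj : ∀ {x y} → Adj G x y → InU G y → InU G x
  InU-adj {x} {y} x~y y∈U a b x⇝a x⇝b = y∈U a b (Reach-trans y⇝x x⇝a) (Reach-trans y⇝x x⇝b)
    where
    y⇝x : Reach G y x
    y⇝x = step here (Adj-sym x~y)

  Pendant : Fin n → Fin n → Set
  Pendant x p = Adj G p x × (∀ {y} → Adj G p y → y ≡ x)

  -- A leaf of G − U has no neighbour in U either, since U is closed under adjacency.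
  leaf⇒pendant : ∀ {x l} → ¬ InU G x → Adj G x l → Leaf G l → Pendant x l
  leaf⇒pendant {x} {l} x∉U x~l (l∉U , _ , _ , _ , unique) =
    l~x , λ l~y → trans (unique _ (l∉U ∘ InU-adj l~y) l~y) (sym (unique _ x∉U l~x))
    where
    l~x : Adj G l x
    l~x = Adj-sym x~l

  type2⇒pendantPair : ∀ {x} → Type2 G x → ∃[ P ] (∣ P ∣ ≡ 2 × (∀ {p} → p ∈ P → Pendant x p))
  type2⇒pendantPair {x} ((x∉U , _) , l₁ , l₂ , l₁≢l₂ , leaf₁ , leaf₂ , x~l₁ , x~l₂ , _) =
    ⁅ l₁ ⁆ ∪ ⁅ l₂ ⁆ , ∣⁅x⁆∪⁅y⁆∣≡2 l₁≢l₂ , pendant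
    where
    pendant : ∀ {p} → p ∈ ⁅ l₁ ⁆ ∪ ⁅ l₂ ⁆ → Pendant x p
    pendant p∈ with x∈⁅y⁆∪⁅z⁆⁻ p∈
    ... | inj₁ refl = leaf⇒pendant x∉U x~l₁ leaf₁
    ... | inj₂ refl = leaf⇒pendant x∉U x~l₂ leaf₂

  pair-independent : ∀ {x y} → ¬ Adj G x y → Independent G (⁅ x ⁆ ∪ ⁅ y ⁆)
  pair-independent x≁y a b a∈ b∈ a~b with x∈⁅y⁆∪⁅z⁆⁻ a∈ | x∈⁅y⁆∪⁅z⁆⁻ b∈
  ... | inj₁ refl | inj₁ refl = Adj-irrefl a~b
  ... | inj₁ refl | inj₂ refl = x≁y a~b
  ... | inj₂ refl | inj₁ refl = x≁y (Adj-sym a~b)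
  ... | inj₂ refl | inj₂ refl = Adj-irrefl a~b

  Dominated : Subset n → Fin n → Set
  Dominated S x = ∃[ y ] (y ∈ S × Adj G y x)

  Covered : Subset n → Fin n → Set
  Covered S x = x ∈ S ⊎ Dominated S x

  Covered-mono : ∀ {S T x} → S ⊆ T → Covered S x → Covered T x
  Covered-mono S⊆T (inj₁ x∈S) = inj₁ (S⊆T x∈S)
  Covered-mono S⊆T (inj₂ (y , y∈S , y~x)) = inj₂ (y , S⊆T y∈S , y~x)

  dominated? : ∀ S x → Dec (Dominated S x)
  dominated? S x = any? λ y → (y ∈? S) ×-dec (adj y x Bool.≟ true)

  addIfUndominated : Subset n → Fin n → Subset n
  addIfUndominated S x with dominated? S x
  ... | yes _ = S
  ... | no  _ = S ∪ ⁅ x ⁆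

  addIfUndominated-⊇ : ∀ S x → S ⊆ addIfUndominated S x
  addIfUndominated-⊇ S x with dominated? S x
  ... | yes _ = λ y∈S → y∈S
  ... | no  _ = p⊆p∪q ⁅ x ⁆

  addIfUndominated-covers : ∀ S x → Covered (addIfUndominated S x) x
  addIfUndominated-covers S x with dominated? S x
  ... | yes dom = inj₂ dom
  ... | no  _   = inj₁ (q⊆p∪q S ⁅ x ⁆ (x∈⁅x⁆ x))

  addIfUndominated-independent : ∀ {S} x → Independent G S → Independent G (addIfUndominated S x)
  addIfUndominated-independent {S} x indep with dominated? S x
  ... | yes _   = indep
  ... | no  ¬dom = λ a b a∈ b∈ → independent (x∈p∪q⁻ S ⁅ x ⁆ a∈) (x∈p∪q⁻ S ⁅ x ⁆ b∈)
    where
    independent : ∀ {a b} → a ∈ S ⊎ a ∈ ⁅ x ⁆ → b ∈ S ⊎ b ∈ ⁅ x ⁆ → ¬ Adj G a b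
    independent (inj₁ a∈S) (inj₁ b∈S) a~b = indep _ _ a∈S b∈S a~b
    independent (inj₁ a∈S) (inj₂ b∈⁅x⁆) a~b with refl ← x∈⁅y⁆⇒x≡y x b∈⁅x⁆ = ¬dom (_ , a∈S , a~b)
    independent (inj₂ a∈⁅x⁆) (inj₁ b∈S) a~b with refl ← x∈⁅y⁆⇒x≡y x a∈⁅x⁆ = ¬dom (_ , b∈S , Adj-sym a~b)
    independent (inj₂ a∈⁅x⁆) (inj₂ b∈⁅x⁆) a~b
      with refl ← x∈⁅y⁆⇒x≡y x a∈⁅x⁆ | refl ← x∈⁅y⁆⇒x≡y x b∈⁅x⁆ = Adj-irrefl a~b

  greedy : Subset n → List (Fin n) → Subset n
  greedy S []       = S
  greedy S (x ∷ xs) = greedy (addIfUndominated S x) xs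

  greedy-⊇ : ∀ S xs → S ⊆ greedy S xs
  greedy-⊇ S []       = λ y∈S → y∈S
  greedy-⊇ S (x ∷ xs) = greedy-⊇ _ xs ∘ addIfUndominated-⊇ S x

  greedy-independent : ∀ {S} xs → Independent G S → Independent G (greedy S xs)
  greedy-independent []       indep = indep
  greedy-independent (x ∷ xs) indep = greedy-independent xs (addIfUndominated-independent x indep)

  greedy-covers : ∀ S {xs x} → x List.∈ xs → Covered (greedy S xs) x
  greedy-covers S {x ∷ xs} (Any.here refl) = Covered-mono (greedy-⊇ _ xs) (addIfUndominated-covers S x)
  greedy-covers S {x ∷ xs} (Any.there x∈xs) = greedy-covers _ x∈xs

  extendToMaximal : ∀ {S} → Independent G S → ∃[ M ] (S ⊆ M × MaximalIndependent G M)
  extendToMaximal {S} indep =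
    M , greedy-⊇ S (allFin n) , greedy-independent (allFin n) indep , dominated
    where
    M : Subset n
    M = greedy S (allFin n)
    dominated : ∀ x → x ∉ M → Dominated M x
    dominated x x∉M with greedy-covers S (∈-allFin x)
    ... | inj₁ x∈M = ⊥-elim (x∉M x∈M)
    ... | inj₂ dom = dom

  swap-independent : ∀ {M P x} → Independent G M → (∀ {p} → p ∈ P → Pendant x p) →
                     Independent G ((M - x) ∪ P)
  swap-independent {M} {P} {x} indep pendant a b a∈ b∈ =
    independent (x∈p∪q⁻ (M - x) P a∈) (x∈p∪q⁻ (M - x) P b∈)
    where
    pendant-apart : ∀ {p q} → p ∈ P → q ∈ M - x ⊎ q ∈ P → ¬ Adj G p q
    pendant-apart p∈P (inj₁ q∈M-x) p~q = x∈p-y⇒x≢y q∈M-x (proj₂ (pendant p∈P) p~q)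
    pendant-apart p∈P (inj₂ q∈P)   p~q with refl ← proj₂ (pendant p∈P) p~q = Adj-irrefl (proj₁ (pendant q∈P))
    independent : ∀ {a b} → a ∈ M - x ⊎ a ∈ P → b ∈ M - x ⊎ b ∈ P → ¬ Adj G a b
    independent (inj₁ a∈M-x) (inj₁ b∈M-x) = indep _ _ (p─q⊆p M ⁅ x ⁆ a∈M-x) (p─q⊆p M ⁅ x ⁆ b∈M-x)
    independent (inj₂ a∈P)   b∈           = pendant-apart a∈P b∈
    independent a∈           (inj₂ b∈P)   = pendant-apart b∈P a∈ ∘ Adj-sym

  swap-size : ∀ {M P x} → Independent G M → x ∈ M → (∀ {p} → p ∈ P → Pendant x p) →
              ∣ (M - x) ∪ P ∣ + 1 ≡ ∣ M ∣ + ∣ P ∣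
  swap-size {M} {P} {x} indep x∈M pendant = begin
    ∣ (M - x) ∪ P ∣ + 1 ≡⟨ cong (_+ 1) (∣p∪q∣≡∣p∣+∣q∣ disjoint) ⟩
    ∣M-x∣ + ∣ P ∣ + 1   ≡⟨ +-assoc ∣M-x∣ ∣ P ∣ 1 ⟩
    ∣M-x∣ + (∣ P ∣ + 1) ≡⟨ cong (∣M-x∣ +_) (+-comm ∣ P ∣ 1) ⟩
    ∣M-x∣ + (1 + ∣ P ∣) ≡⟨ +-assoc ∣M-x∣ 1 ∣ P ∣ ⟨
    ∣M-x∣ + 1 + ∣ P ∣   ≡⟨ cong (_+ ∣ P ∣) (x∈p⇒∣p-x∣+1≡∣p∣ x∈M) ⟩
    ∣ M ∣ + ∣ P ∣       ∎
    where
    open ≡-Reasoning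
    ∣M-x∣ : ℕ
    ∣M-x∣ = ∣ M - x ∣
    disjoint : ∀ {a} → a ∈ M - x → a ∉ P
    disjoint a∈M-x a∈P = indep _ _ (p─q⊆p M ⁅ x ⁆ a∈M-x) x∈M (proj₁ (pendant a∈P))

  swap-pendantPair : ∀ {M P x} → Independent G M → x ∈ M → ∣ P ∣ ≡ 2 → (∀ {p} → p ∈ P → Pendant x p) →
                     Independent G ((M - x) ∪ P) × ∣ (M - x) ∪ P ∣ ≡ suc ∣ M ∣
  swap-pendantPair {M} {P} {x} indep x∈M ∣P∣≡2 pendant =
    swap-independent indep pendant ,
    suc-injective (begin
      suc ∣ (M - x) ∪ P ∣ ≡⟨ +-comm 1 ∣ (M - x) ∪ P ∣ ⟩
      ∣ (M - x) ∪ P ∣ + 1 ≡⟨ swap-size indep x∈M pendant ⟩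
      ∣ M ∣ + ∣ P ∣       ≡⟨ cong (∣ M ∣ +_) ∣P∣≡2 ⟩
      ∣ M ∣ + 2           ≡⟨ +-comm ∣ M ∣ 2 ⟩
      suc (suc ∣ M ∣)     ∎)
    where open ≡-Reasoning

  ¬¬type2-adjacent : AlmostWellCovered G → ∀ {u v} → Type2 G u → Type2 G v → u ≢ v → ¬ ¬ Adj G u v
  ¬¬type2-adjacent (α , ι , (_ , indep≤α) , (_ , ι≤maximal) , α≡ι+1) {u} {v} type2-u type2-v u≢v u≁v
    with extendToMaximal (pair-independent u≁v) | type2⇒pendantPair type2-u | type2⇒pendantPair type2-v
  ... | M , uv⊆M , maximal | Pu , ∣Pu∣≡2 , pendant-u | Pv , ∣Pv∣≡2 , pendant-v =
    1+n≰n (begin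
      suc (suc ι)     ≤⟨ s≤s (s≤s (ι≤maximal M maximal)) ⟩
      suc (suc ∣ M ∣) ≡⟨ cong suc (proj₂ swap₁) ⟨
      suc ∣ M₁ ∣      ≡⟨ proj₂ swap₂ ⟨
      ∣ M₂ ∣          ≤⟨ indep≤α M₂ (proj₁ swap₂) ⟩
      α               ≡⟨ α≡ι+1 ⟩
      ι + 1           ≡⟨ +-comm ι 1 ⟩
      suc ι           ∎)
    where
    open ≤-Reasoning
    u∈M : u ∈ M
    u∈M = uv⊆M (p⊆p∪q ⁅ v ⁆ (x∈⁅x⁆ u))
    v∈M : v ∈ M
    v∈M = uv⊆M (q⊆p∪q ⁅ u ⁆ ⁅ v ⁆ (x∈⁅x⁆ v))
    M₁ M₂ : Subset n
    M₁ = (M - u) ∪ Pu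
    M₂ = (M₁ - v) ∪ Pv
    swap₁ : Independent G M₁ × ∣ M₁ ∣ ≡ suc ∣ M ∣
    swap₁ = swap-pendantPair (proj₁ maximal) u∈M ∣Pu∣≡2 pendant-u
    v∈M₁ : v ∈ M₁
    v∈M₁ = p⊆p∪q Pu (x∈p∧x≢y⇒x∈p-y v∈M (u≢v ∘ sym))
    swap₂ : Independent G M₂ × ∣ M₂ ∣ ≡ suc ∣ M₁ ∣
    swap₂ = swap-pendantPair (proj₁ swap₁) v∈M₁ ∣Pv∣≡2 pendant-v

lemma2p7 : ∀ {n : ℕ} (G : Graph n) → AlmostWellCovered G →
    ∀ (u v : Fin n) → Type2 G u → Type2 G v → u ≢ v → Adj G u v
lemma2p7 G awc u v type2-u type2-v u≢v =
  decidable-stable (Graph.adj G u v Bool.≟ true) (¬¬type2-adjacent G awc type2-u type2-v u≢v)
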